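{- Let $F$ be a field of characteristic $p\neq 3$. Let $L_1/F$ and $L_2/F$ be two extensions of degree $3$, and for $i=1,2$ let $y_i$ be a generator of $L_i/F$ with $y_i^3-3y_i=a_i$, $a_i\in F$, such that the polynomial $X^2+a_iX+1$ is irreducible over $F$. Then the following are equivalent: (1) $L_1\simeq L_2$ as extensions of $F$; (2) there exist $\alpha,\beta\in F$ with $\alpha^2+a_2\alpha\beta+\beta^2=1$ such that, under an $F$-isomorphism identifying $L_1$ with $L_2$, $y_1=\alpha y_2^2+\beta y_2-2\alpha$; (3) there exist $\alpha,\beta\in F$ with $\alpha^2+a_2\alpha\beta+\beta^2=1$ such that $a_1=-3a_2\alpha^2\beta+a_2\beta^3+6\alpha+\alpha^3a_2^2-8\alpha^3$. -}

module Defs where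

open import Level using (Level; _⊔_) renaming (suc to lsuc)
open import Algebra.Bundles using (CommutativeRing)
open import Algebra.Morphism.Structures using (module RingMorphisms)
open import Data.Fin using (Fin) renaming (zero to fz; suc to fs)
open import Data.List using (List; []; _∷_)
open import Data.Product using (Σ; ∃; _×_; _,_)
open import Relation.Nullary using (¬_)

private variable c ℓ c₁ ℓ₁ c₂ ℓ₂ : Level

record Field (c ℓ : Level) : Set (lsuc (c ⊔ ℓ)) where
  field
    commutativeRing : CommutativeRing c ℓ
  open CommutativeRing commutativeRing public
  field
    1≉0     : ¬ (1# ≈ 0#)
    inverse : ∀ x → ¬ (x ≈ 0#) → ∃ λ y → x * y ≈ 1#

  three : Carrier
  three = 1# + (1# + 1#)

  two : Carrier
  two = 1# + 1#

  six : Carrier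
  six = two * three

  eight : Carrier
  eight = two * (two * two)

charNot3 : Field c ℓ → Set ℓ
charNot3 F = ¬ (three ≈ 0#) where open Field F

-- The monic quadratic X² + aX + 1 is reducible over F iff it factors as
-- (X + r)(X + s) with r, s ∈ F, i.e. r + s = a and r s = 1
-- (a factorisation of a monic quadratic into non-units is, up to units,
-- a product of two monic linear factors).
QuadReducible : (F : Field c ℓ) → Field.Carrier F → Set (c ⊔ ℓ)
QuadReducible F a = ∃ λ r → ∃ λ s → (r + s ≈ a) × (r * s ≈ 1#)
  where open Field F

QuadIrreducible : (F : Field c ℓ) → Field.Carrier F → Set (c ⊔ ℓ)
QuadIrreducible F a = ¬ QuadReducible F a

-- A field extension L/F: a field L with a ring homomorphism F → L
-- (automatically injective since F is a field).
record Extension (F : Field c ℓ) (c₁ ℓ₁ : Level) : Set (c ⊔ ℓ ⊔ lsuc (c₁ ⊔ ℓ₁)) where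
  field
    L : Field c₁ ℓ₁
  open Field L public
  field
    ι     : Field.Carrier F → Carrier
    ι-hom : RingMorphisms.IsRingHomomorphism
              (Field.rawRing F) (Field.rawRing L) ι

  infixl 7 _·_
  _·_ : Field.Carrier F → Carrier → Carrier
  c · x = ι c * x

  evalPoly : List (Field.Carrier F) → Carrier → Carrier
  evalPoly []       y = 0#
  evalPoly (c ∷ cs) y = ι c + y * evalPoly cs y

  lin3 : (Fin 3 → Field.Carrier F) → (Fin 3 → Carrier) → Carrier
  lin3 k e = k fz · e fz + (k (fs fz) · e (fs fz)
                                 + k (fs (fs fz)) · e (fs (fs fz)))

  IsBasis3 : (Fin 3 → Carrier) → Set (c ⊔ ℓ ⊔ c₁ ⊔ ℓ₁)
  IsBasis3 e =
    (∀ x → ∃ λ k → x ≈ lin3 k e)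
    × (∀ k → lin3 k e ≈ 0# → ∀ i → Field._≈_ F (k i) (Field.0# F))

  Degree3 : Set (c ⊔ ℓ ⊔ c₁ ⊔ ℓ₁)
  Degree3 = ∃ λ e → IsBasis3 e

  -- y generates L over F: L = F[y] (= F(y), L/F being finite), i.e.
  -- every element of L is a polynomial in y with coefficients in F.
  Generates : Carrier → Set (c ⊔ c₁ ⊔ ℓ₁)
  Generates y = ∀ x → ∃ λ cs → x ≈ evalPoly cs y

record FIso {F : Field c ℓ} (E₁ : Extension F c₁ ℓ₁) (E₂ : Extension F c₂ ℓ₂)
       : Set (c ⊔ c₁ ⊔ ℓ₁ ⊔ c₂ ⊔ ℓ₂) where
  module E₁ = Extension E₁
  module E₂ = Extension E₂
  field
    φ      : E₁.Carrier → E₂.Carrier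
    φ-iso  : RingMorphisms.IsRingIsomorphism E₁.rawRing E₂.rawRing φ
    φ-fixF : ∀ x → φ (E₁.ι x) E₂.≈ E₂.ι x

Isomorphic : {F : Field c ℓ} → Extension F c₁ ℓ₁ → Extension F c₂ ℓ₂
           → Set (c ⊔ c₁ ⊔ ℓ₁ ⊔ c₂ ⊔ ℓ₂)
Isomorphic E₁ E₂ = FIso E₁ E₂

module Submission where

-- Since [Lᵢ : F] = 3 and yᵢ generates Lᵢ, the powers 1, yᵢ, yᵢ² form an F-basis of Lᵢ (a
-- determinant argument), so elements are coordinate triples multiplied modulo X³ - 3X - aᵢ.
-- An F-isomorphism L₁ ≅ L₂ is fixed by the image z = C + By₂ + Ay₂² of y₁, and
-- z³ - 3z = a₁ says that the y₂- and y₂²-coordinates of z³ - 3z vanish. These two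
-- equations force the trace 3(C + 2A) of z to vanish and then A² + a₂AB + B² = 1, while the
-- constant coordinate gives the formula for a₁; the degenerate alternatives are excluded
-- because X³ - 3X - aᵢ has no root in F and X² + a₂X + 1 is irreducible. Conversely, for such
-- α, β the element z = αy₂² + βy₂ - 2α is a root of X³ - 3X - a₁ and y₂ is a polynomial in z,
-- so 1, z, z² is another power basis of L₂ and y₁ ↦ z extends to an F-isomorphism.

open import Defs
open import Algebra.Bundles using (CommutativeRing; RawRing; Ring)
open import Algebra.Morphism.Structures using (module RingMorphisms)
open import Algebra.Solver.Ring.AlmostCommutativeRing
  using (fromCommutativeRing; _-Raw-AlmostCommutative⟶_)
open import Data.Nat as ℕ using (ℕ; zero; suc)
open import Data.Integer as ℤ using (ℤ; +_; -[1+_]; _⊖_)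
import Data.Integer.Properties as ℤ
import Data.Nat.Properties as ℕ
open import Data.Fin using (Fin)
open import Data.Fin.Patterns using (0F; 1F; 2F; 3F; 4F; 5F; 6F)
open import Data.List using ([]; _∷_)
open import Data.Maybe using (Maybe; just; nothing)
open import Data.Product using (∃; _×_; _,_; proj₁; proj₂)
open import Data.Vec.Functional using (Vector) renaming ([] to ⟨⟩; _∷_ to _◂_)
open import Data.Vec.N-ary using (N-ary)
open import Function using (_∘_)
open import Level using (Level; 0ℓ; _⊔_)
open import Relation.Nullary using (¬_; yes; no)
open import Relation.Binary.PropositionalEquality as ≡ using (_≡_)

-- The library's solver instances need decidable equality or have ℕ coefficients, which cannot
-- cancel subtractions; ℤ coefficients work in every commutative ring.
module IntegerCoefficients {c ℓ} (R : CommutativeRing c ℓ) where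
  open CommutativeRing R hiding (zero)
  open import Algebra.Properties.Semiring.Mult.TCOptimised semiring renaming (_×_ to _×′_)
  open import Algebra.Properties.Ring ring
    using (-0#≈0#; -‿involutive; -‿+-comm; -‿distribˡ-*; -‿distribʳ-*)
  open import Relation.Binary.Reasoning.Setoid setoid

  -- With the optimised multiple, 1 ×′ 1# is 1#, so con (+ 1) :+ (con (+ 1) :+ con (+ 1))
  -- evaluates to exactly the three of Defs.
  ⟦_⟧ℤ : ℤ → Carrier
  ⟦ + n ⟧ℤ      = n ×′ 1#
  ⟦ -[1+ n ] ⟧ℤ = - (suc n ×′ 1#)

  ⟦-⟧ℤ : ∀ i → ⟦ ℤ.- i ⟧ℤ ≈ - ⟦ i ⟧ℤ
  ⟦-⟧ℤ (+ zero)  = sym -0#≈0#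
  ⟦-⟧ℤ (+ suc n) = refl
  ⟦-⟧ℤ -[1+ n ]  = sym (-‿involutive _)

  ⟦⊖⟧ℤ : ∀ m n → ⟦ m ⊖ n ⟧ℤ ≈ m ×′ 1# - n ×′ 1#
  ⟦⊖⟧ℤ m zero rewrite ℤ.⊖-≥ {m} {zero} ℕ.z≤n = begin
    m ×′ 1#       ≈⟨ +-identityʳ _ ⟨
    m ×′ 1# + 0#  ≈⟨ +-congˡ -0#≈0# ⟨
    m ×′ 1# - 0#  ∎
  ⟦⊖⟧ℤ zero (suc n) = sym (+-identityˡ _)
  ⟦⊖⟧ℤ (suc m) (suc n) rewrite ℤ.[1+m]⊖[1+n]≡m⊖n m n = begin
    ⟦ m ⊖ n ⟧ℤ                         ≈⟨ ⟦⊖⟧ℤ m n ⟩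
    m ×′ 1# - n ×′ 1#                  ≈⟨ 1+-cancel (m ×′ 1#) (n ×′ 1#) ⟨
    (1# + m ×′ 1#) - (1# + n ×′ 1#)    ≈⟨ +-cong (1+× m 1#) (-‿cong (1+× n 1#)) ⟨
    suc m ×′ 1# - suc n ×′ 1#          ∎
    where
    1+-cancel : ∀ x y → (1# + x) - (1# + y) ≈ x - y
    1+-cancel x y = begin
      (1# + x) - (1# + y)    ≈⟨ +-cong (+-comm 1# x) (sym (-‿+-comm 1# y)) ⟩
      (x + 1#) + (- 1# - y)  ≈⟨ +-assoc x 1# _ ⟩
      x + (1# + (- 1# - y))  ≈⟨ +-congˡ (+-assoc 1# (- 1#) _) ⟨
      x + ((1# - 1#) - y)    ≈⟨ +-congˡ (+-congʳ (-‿inverseʳ 1#)) ⟩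
      x + (0# - y)           ≈⟨ +-congˡ (+-identityˡ _) ⟩
      x - y                  ∎

  ⟦+⟧ℤ : ∀ i j → ⟦ i ℤ.+ j ⟧ℤ ≈ ⟦ i ⟧ℤ + ⟦ j ⟧ℤ
  ⟦+⟧ℤ (+ m)    (+ n)    = ×-homo-+ 1# m n
  ⟦+⟧ℤ (+ m)    -[1+ n ] = ⟦⊖⟧ℤ m (suc n)
  ⟦+⟧ℤ -[1+ m ] (+ n)    = trans (⟦⊖⟧ℤ n (suc m)) (+-comm _ _)
  ⟦+⟧ℤ -[1+ m ] -[1+ n ] = begin
    - (suc (suc (m ℕ.+ n)) ×′ 1#)        ≡⟨ ≡.cong (λ k → - (suc k ×′ 1#)) (ℕ.+-suc m n) ⟨
    - ((suc m ℕ.+ suc n) ×′ 1#)          ≈⟨ -‿cong (×-homo-+ 1# (suc m) (suc n)) ⟩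
    - (suc m ×′ 1# + suc n ×′ 1#)        ≈⟨ -‿+-comm _ _ ⟨
    - (suc m ×′ 1#) + - (suc n ×′ 1#)    ∎

  ⟦+*⟧ℤ : ∀ m j → ⟦ + m ℤ.* j ⟧ℤ ≈ ⟦ + m ⟧ℤ * ⟦ j ⟧ℤ
  ⟦+*⟧ℤ m (+ n) rewrite ≡.sym (ℤ.pos-* m n) = ×1-homo-* m n
  ⟦+*⟧ℤ m -[1+ n ] = begin
    ⟦ + m ℤ.* -[1+ n ] ⟧ℤ         ≡⟨ ≡.cong ⟦_⟧ℤ (ℤ.neg-distribʳ-* (+ m) (+ suc n)) ⟨
    ⟦ ℤ.- (+ m ℤ.* + suc n) ⟧ℤ    ≈⟨ ⟦-⟧ℤ (+ m ℤ.* + suc n) ⟩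
    - ⟦ + m ℤ.* + suc n ⟧ℤ        ≈⟨ -‿cong (⟦+*⟧ℤ m (+ suc n)) ⟩
    - (m ×′ 1# * (suc n ×′ 1#))   ≈⟨ -‿distribʳ-* _ _ ⟩
    m ×′ 1# * - (suc n ×′ 1#)     ∎

  ⟦*⟧ℤ : ∀ i j → ⟦ i ℤ.* j ⟧ℤ ≈ ⟦ i ⟧ℤ * ⟦ j ⟧ℤ
  ⟦*⟧ℤ (+ m)    j = ⟦+*⟧ℤ m j
  ⟦*⟧ℤ -[1+ m ] j = begin
    ⟦ -[1+ m ] ℤ.* j ⟧ℤ          ≡⟨ ≡.cong ⟦_⟧ℤ (ℤ.neg-distribˡ-* (+ suc m) j) ⟨
    ⟦ ℤ.- (+ suc m ℤ.* j) ⟧ℤ     ≈⟨ ⟦-⟧ℤ (+ suc m ℤ.* j) ⟩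
    - ⟦ + suc m ℤ.* j ⟧ℤ         ≈⟨ -‿cong (⟦+*⟧ℤ (suc m) j) ⟩
    - (suc m ×′ 1# * ⟦ j ⟧ℤ)     ≈⟨ -‿distribˡ-* _ _ ⟩
    - (suc m ×′ 1#) * ⟦ j ⟧ℤ     ∎

  homomorphism : ℤ.+-*-rawRing -Raw-AlmostCommutative⟶ fromCommutativeRing R
  homomorphism = record
    { ⟦_⟧    = ⟦_⟧ℤ
    ; +-homo = ⟦+⟧ℤ
    ; *-homo = ⟦*⟧ℤ
    ; -‿homo = ⟦-⟧ℤ
    ; 0-homo = refl
    ; 1-homo = refl
    }

  equal? : ∀ i j → Maybe (⟦ i ⟧ℤ ≈ ⟦ j ⟧ℤ)
  equal? i j with i ℤ.≟ j
  ... | yes ≡.refl = just refl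
  ... | no _       = nothing

  open import Algebra.Solver.Ring ℤ.+-*-rawRing (fromCommutativeRing R) homomorphism equal? public

  polynomialRawRing : ℕ → RawRing 0ℓ 0ℓ
  polynomialRawRing n = record
    { Carrier = Polynomial n
    ; _≈_     = _≡_
    ; _+_     = _:+_
    ; _*_     = _:*_
    ; -_      = :-_
    ; 0#      = con (+ 0)
    ; 1#      = con (+ 1)
    }

-- Formulas are written once over a raw ring and then read in the field, in an extension, as
-- solver polynomials and as terms.
module RawRingNotation {c ℓ} (R : RawRing c ℓ) where
  open RawRing R

  infixl 6 _-_
  _-_ : Carrier → Carrier → Carrier
  x - y = x + - y

  two three six eight : Carrier
  two   = 1# + 1#
  three = 1# + (1# + 1#)
  six   = two * three
  eight = two * (two * two)

infixl 6 _+ᵗ_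
infixl 7 _*ᵗ_
infix 8 -ᵗ_
data Term (n : ℕ) : Set where
  var       : Fin n → Term n
  0ᵗ 1ᵗ     : Term n
  _+ᵗ_ _*ᵗ_ : Term n → Term n → Term n
  -ᵗ_       : Term n → Term n

termRawRing : ℕ → RawRing 0ℓ 0ℓ
termRawRing n = record
  { Carrier = Term n ; _≈_ = _≡_ ; _+_ = _+ᵗ_ ; _*_ = _*ᵗ_ ; -_ = -ᵗ_ ; 0# = 0ᵗ ; 1# = 1ᵗ }

cubicTerm : Term 1
cubicTerm = x *ᵗ (x *ᵗ x) - three *ᵗ x
  where
  open RawRingNotation (termRawRing 1) using (_-_; three)
  x = var 0F

module _ {c ℓ} (R : RawRing c ℓ) where
  open RawRing R

  ⟦_⟧ᵗ : ∀ {n} → Term n → Vector Carrier n → Carrier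
  ⟦ var i  ⟧ᵗ ρ = ρ i
  ⟦ 0ᵗ     ⟧ᵗ ρ = 0#
  ⟦ 1ᵗ     ⟧ᵗ ρ = 1#
  ⟦ s +ᵗ t ⟧ᵗ ρ = ⟦ s ⟧ᵗ ρ + ⟦ t ⟧ᵗ ρ
  ⟦ s *ᵗ t ⟧ᵗ ρ = ⟦ s ⟧ᵗ ρ * ⟦ t ⟧ᵗ ρ
  ⟦ -ᵗ t   ⟧ᵗ ρ = - ⟦ t ⟧ᵗ ρ

module _ {c₁ ℓ₁ c₂ ℓ₂} {R : RawRing c₁ ℓ₁} {S : Ring c₂ ℓ₂} {h : RawRing.Carrier R → Ring.Carrier S}
         (isHom : RingMorphisms.IsRingHomomorphism R (Ring.rawRing S) h) where
  open Ring S
  open RingMorphisms.IsRingHomomorphism isHom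

  ⟦⟧ᵗ-homo : ∀ {n} (t : Term n) ρ → h (⟦ R ⟧ᵗ t ρ) ≈ ⟦ Ring.rawRing S ⟧ᵗ t (h ∘ ρ)
  ⟦⟧ᵗ-homo (var i)  ρ = refl
  ⟦⟧ᵗ-homo 0ᵗ       ρ = 0#-homo
  ⟦⟧ᵗ-homo 1ᵗ       ρ = 1#-homo
  ⟦⟧ᵗ-homo (s +ᵗ t) ρ = trans (+-homo _ _) (+-cong (⟦⟧ᵗ-homo s ρ) (⟦⟧ᵗ-homo t ρ))
  ⟦⟧ᵗ-homo (s *ᵗ t) ρ = trans (*-homo _ _) (*-cong (⟦⟧ᵗ-homo s ρ) (⟦⟧ᵗ-homo t ρ))
  ⟦⟧ᵗ-homo (-ᵗ t)   ρ = trans (-‿homo _) (-‿cong (⟦⟧ᵗ-homo t ρ))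

module Matrix3 {c ℓ} (R : RawRing c ℓ) where
  open RawRing R
  open RawRingNotation R using (_-_)

  infixl 7 _∙_ _⊛_ _⊗_
  _∙_ : Vector Carrier 3 → Vector Carrier 3 → Carrier
  u ∙ v = u 0F * v 0F + (u 1F * v 1F + u 2F * v 2F)

  Matrix : Set c
  Matrix = Vector (Vector Carrier 3) 3

  _⊛_ : Vector Carrier 3 → Matrix → Vector Carrier 3
  (t ⊛ M) j = t ∙ λ i → M i j

  _⊗_ : Matrix → Matrix → Matrix
  (N ⊗ M) i = N i ⊛ M

  matrix : Carrier → Carrier → Carrier → Carrier → Carrier → Carrier → Carrier → Carrier → Carrier → Matrix
  matrix a b c d e f g h i = (a ◂ b ◂ c ◂ ⟨⟩) ◂ (d ◂ e ◂ f ◂ ⟨⟩) ◂ (g ◂ h ◂ i ◂ ⟨⟩) ◂ ⟨⟩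

  identity : Matrix
  identity = matrix 1# 0# 0# 0# 1# 0# 0# 0# 1#

  det : Matrix → Carrier
  det M = M 0F 0F * (M 1F 1F * M 2F 2F - M 1F 2F * M 2F 1F)
        - M 0F 1F * (M 1F 0F * M 2F 2F - M 1F 2F * M 2F 0F)
        + M 0F 2F * (M 1F 0F * M 2F 1F - M 1F 1F * M 2F 0F)

  next : Fin 3 → Fin 3
  next 0F = 1F
  next 1F = 2F
  next 2F = 0F

  -- With indices read cyclically, the cofactors need no signs.
  adjugate : Matrix → Matrix
  adjugate M i j = M j′ i′ * M j″ i″ - M j′ i″ * M j″ i′
    where
    i′ = next i
    i″ = next i′
    j′ = next j
    j″ = next j′

module Matrix3Properties {c ℓ} (R : CommutativeRing c ℓ) where
  open CommutativeRing R
  open Matrix3 rawRing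
  open IntegerCoefficients R
  private module ℙ {n} = Matrix3 (polynomialRawRing n)
  open import Relation.Binary.Reasoning.Setoid setoid

  ∙-congˡ : ∀ u u′ e → (∀ i → u i ≈ u′ i) → u ∙ e ≈ u′ ∙ e
  ∙-congˡ _ _ e u≈ = +-cong (*-congʳ (u≈ 0F)) (+-cong (*-congʳ (u≈ 1F)) (*-congʳ (u≈ 2F)))

  ∙-congʳ : ∀ u e e′ → (∀ i → e i ≈ e′ i) → u ∙ e ≈ u ∙ e′
  ∙-congʳ u _ _ e≈ = +-cong (*-congˡ (e≈ 0F)) (+-cong (*-congˡ (e≈ 1F)) (*-congˡ (e≈ 2F)))

  det-⊗ : ∀ N M → det (N ⊗ M) ≈ det N * det M
  det-⊗ N M = solve 18
    (λ n₀₀ n₀₁ n₀₂ n₁₀ n₁₁ n₁₂ n₂₀ n₂₁ n₂₂ m₀₀ m₀₁ m₀₂ m₁₀ m₁₁ m₁₂ m₂₀ m₂₁ m₂₂ →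
      let N′ = ℙ.matrix n₀₀ n₀₁ n₀₂ n₁₀ n₁₁ n₁₂ n₂₀ n₂₁ n₂₂
          M′ = ℙ.matrix m₀₀ m₀₁ m₀₂ m₁₀ m₁₁ m₁₂ m₂₀ m₂₁ m₂₂
      in ℙ.det (N′ ℙ.⊗ M′) := ℙ.det N′ :* ℙ.det M′)
    refl (N 0F 0F) (N 0F 1F) (N 0F 2F) (N 1F 0F) (N 1F 1F) (N 1F 2F) (N 2F 0F) (N 2F 1F) (N 2F 2F)
         (M 0F 0F) (M 0F 1F) (M 0F 2F) (M 1F 0F) (M 1F 1F) (M 1F 2F) (M 2F 0F) (M 2F 1F) (M 2F 2F)

  det-identity : det identity ≈ 1#
  det-identity = solve 0 (ℙ.det ℙ.identity := con (+ 1)) refl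

  det-cong : ∀ {M M′} → (∀ i j → M i j ≈ M′ i j) → det M ≈ det M′
  det-cong {M} {M′} M≈ =
    +-cong (+-cong (*-cong (M≈ 0F 0F) (minor 1F 1F 2F 2F)) (-‿cong (*-cong (M≈ 0F 1F) (minor 1F 0F 2F 2F))))
           (*-cong (M≈ 0F 2F) (minor 1F 0F 2F 1F))
    where
    minor : ∀ i j k l → M i j * M k l - M i l * M k j ≈ M′ i j * M′ k l - M′ i l * M′ k j
    minor i j k l = +-cong (*-cong (M≈ i j) (M≈ k l)) (-‿cong (*-cong (M≈ i l) (M≈ k j)))

  private
    adjugate-law : Fin 3 → N-ary 12 (Polynomial 12) (Polynomial 12 × Polynomial 12)
    adjugate-law i t₀ t₁ t₂ m₀₀ m₀₁ m₀₂ m₁₀ m₁₁ m₁₂ m₂₀ m₂₁ m₂₂ =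
      (t ℙ.⊛ M ℙ.⊛ ℙ.adjugate M) i := t i :* ℙ.det M
      where
      t = t₀ ◂ t₁ ◂ t₂ ◂ ⟨⟩
      M = ℙ.matrix m₀₀ m₀₁ m₀₂ m₁₀ m₁₁ m₁₂ m₂₀ m₂₁ m₂₂

  ⊛-adjugate : ∀ t M i → (t ⊛ M ⊛ adjugate M) i ≈ t i * det M
  ⊛-adjugate t M 0F = solve 12 (adjugate-law 0F) refl (t 0F) (t 1F) (t 2F)
    (M 0F 0F) (M 0F 1F) (M 0F 2F) (M 1F 0F) (M 1F 1F) (M 1F 2F) (M 2F 0F) (M 2F 1F) (M 2F 2F)
  ⊛-adjugate t M 1F = solve 12 (adjugate-law 1F) refl (t 0F) (t 1F) (t 2F)
    (M 0F 0F) (M 0F 1F) (M 0F 2F) (M 1F 0F) (M 1F 1F) (M 1F 2F) (M 2F 0F) (M 2F 1F) (M 2F 2F)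
  ⊛-adjugate t M 2F = solve 12 (adjugate-law 2F) refl (t 0F) (t 1F) (t 2F)
    (M 0F 0F) (M 0F 1F) (M 0F 2F) (M 1F 0F) (M 1F 1F) (M 1F 2F) (M 2F 0F) (M 2F 1F) (M 2F 2F)

  ⊛-zeroˡ : ∀ {u} M → (∀ j → u j ≈ 0#) → ∀ i → (u ⊛ M) i ≈ 0#
  ⊛-zeroˡ {u} M u≈0 i = begin
    u 0F * M 0F i + (u 1F * M 1F i + u 2F * M 2F i)  ≈⟨ +-cong (vanish 0F) (+-cong (vanish 1F) (vanish 2F)) ⟩
    0# + (0# + 0#)                                   ≈⟨ trans (+-identityˡ _) (+-identityˡ 0#) ⟩
    0#                                               ∎
    where
    vanish : ∀ k → u k * M k i ≈ 0#
    vanish k = trans (*-congʳ (u≈0 k)) (zeroˡ _)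

  left-invertible⇒trivial-kernel : ∀ N M t → (∀ i j → (N ⊗ M) i j ≈ identity i j) →
                                   (∀ j → (t ⊛ M) j ≈ 0#) → ∀ i → t i ≈ 0#
  left-invertible⇒trivial-kernel N M t N⊗M≈I t⊛M≈0 i = begin
    t i                             ≈⟨ *-identityʳ (t i) ⟨
    t i * 1#                        ≈⟨ *-congˡ detN*detM≈1 ⟨
    t i * (det N * det M)           ≈⟨ *-congˡ (*-comm _ _) ⟩
    t i * (det M * det N)           ≈⟨ *-assoc (t i) _ _ ⟨
    t i * det M * det N             ≈⟨ *-congʳ (⊛-adjugate t M i) ⟨
    (t ⊛ M ⊛ adjugate M) i * det N  ≈⟨ *-congʳ (⊛-zeroˡ (adjugate M) t⊛M≈0 i) ⟩
    0# * det N                      ≈⟨ zeroˡ _ ⟩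
    0#                              ∎
    where
    detN*detM≈1 : det N * det M ≈ 1#
    detN*detM≈1 = trans (sym (det-⊗ N M)) (trans (det-cong N⊗M≈I) det-identity)

module CubicFormulas {c ℓ} (R : RawRing c ℓ) where
  open RawRing R
  open RawRingNotation R public

  Coords : Set c
  Coords = Vector Carrier 3

  powers : Carrier → Vector Carrier 3
  powers v = 1# ◂ v ◂ v * v ◂ ⟨⟩

  infixl 6 _+ᶜ_
  infixr 7 _·ᶜ_
  _+ᶜ_ : Coords → Coords → Coords
  (x +ᶜ y) i = x i + y i

  -ᶜ_ : Coords → Coords
  (-ᶜ x) i = - x i

  _·ᶜ_ : Carrier → Coords → Coords
  (c ·ᶜ x) i = c * x i

  constant : Carrier → Coords
  constant c = c ◂ 0# ◂ 0# ◂ ⟨⟩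

  generator : Coords
  generator = 0# ◂ 1# ◂ 0# ◂ ⟨⟩

  -- The product in R[X]/(X³ - 3X - a), reducing with X³ = 3X + a and X⁴ = 3X² + aX.
  multiply : Carrier → Coords → Coords → Coords
  multiply a x y =
    x 0F * y 0F + a * m ◂
    x 0F * y 1F + x 1F * y 0F + (three * m + a * (x 2F * y 2F)) ◂
    x 0F * y 2F + x 1F * y 1F + x 2F * y 0F + three * (x 2F * y 2F) ◂ ⟨⟩
    where m = x 1F * y 2F + x 2F * y 1F

  cubic : Carrier → Coords → Coords
  cubic a x i = multiply a x (multiply a x x) i - three * x i

  -- The coordinates of k₀ + k₁d + k₂d², given those of d.
  substitute : Carrier → Coords → Coords → Coords
  substitute a k d i = constant (k 0F) i + (k 1F * d i + k 2F * multiply a d d i)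

  quadForm : Carrier → Carrier → Carrier → Carrier
  quadForm a α β = α * α + a * α * β + β * β

  -- β³ - 3α²β - aα³ = α³ h(β/α) for h(X) = X³ - 3X - a.
  binaryCubic : Carrier → Carrier → Carrier → Carrier
  binaryCubic a α β = β * (β * β) - three * (α * (α * β)) - a * (α * (α * α))

  cubicParameter : Carrier → Carrier → Carrier → Carrier
  cubicParameter a α β = - (three * a * α * α * β) + a * β * β * β + six * α
                         + α * α * α * a * a - eight * α * α * α

  substituted : Carrier → Carrier → Coords
  substituted α β = - (two * α) ◂ β ◂ α ◂ ⟨⟩

  -- For D = binaryCubic a α β ⁻¹, the coordinates of y with respect to z = αy² + βy - 2α.
  inverseSubstitution : Carrier → Carrier → Carrier → Carrier → Coords
  inverseSubstitution a α β D = two * α * δ - γ * z² 0F ◂ δ ◂ γ ◂ ⟨⟩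
    where
    z² = multiply a (substituted α β) (substituted α β)
    δ = z² 2F * D
    γ = - (α * D)

module FieldProperties {c ℓ} (F : Field c ℓ) where
  open Field F
  open import Algebra.Properties.Group +-group public
    using (x∙y⁻¹≈ε⇒x≈y; x≈y⇒x∙y⁻¹≈ε; inverseˡ-unique)
  open import Relation.Binary.Reasoning.Setoid setoid

  cancelˡ : ∀ {x y} → ¬ x ≈ 0# → x * y ≈ 0# → y ≈ 0#
  cancelˡ {x} {y} x≉0 xy≈0 = begin
    y              ≈⟨ *-identityˡ y ⟨
    1# * y         ≈⟨ *-congʳ (trans (sym xx⁻¹≈1) (*-comm x x⁻¹)) ⟩
    x⁻¹ * x * y    ≈⟨ *-assoc x⁻¹ x y ⟩
    x⁻¹ * (x * y)  ≈⟨ *-congˡ xy≈0 ⟩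
    x⁻¹ * 0#       ≈⟨ zeroʳ x⁻¹ ⟩
    0#             ∎
    where
    x⁻¹ = proj₁ (inverse x x≉0)
    xx⁻¹≈1 = proj₂ (inverse x x≉0)

  *-≉0 : ∀ {x y} → ¬ x ≈ 0# → ¬ y ≈ 0# → ¬ x * y ≈ 0#
  *-≉0 x≉0 y≉0 xy≈0 = y≉0 (cancelˡ x≉0 xy≈0)

  *+*≈0 : ∀ {x y} u v → x ≈ 0# → y ≈ 0# → x * u + y * v ≈ 0#
  *+*≈0 u v x≈0 y≈0 =
    trans (+-cong (trans (*-congʳ x≈0) (zeroˡ u)) (trans (*-congʳ y≈0) (zeroˡ v))) (+-identityʳ 0#)

module CubicAlgebra {c ℓ} (F : Field c ℓ) where
  open Field F
  open FieldProperties F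
  open CubicFormulas rawRing hiding (_-_; two; three; six; eight)
  open IntegerCoefficients commutativeRing
  private module ℙ {n} = CubicFormulas (polynomialRawRing n)
  open import Relation.Binary.Reasoning.Setoid setoid

  NoCubicRoot : Carrier → Set (c ⊔ ℓ)
  NoCubicRoot a = ∀ s → ¬ (s * (s * s) - three * s ≈ a)

  _≈ᶜ_ : Coords → Coords → Set ℓ
  x ≈ᶜ y = ∀ i → x i ≈ y i

  root⇒reducible : ∀ {a} x → x * x + a * x + 1# ≈ 0# → QuadReducible F a
  root⇒reducible {a} x root = - x , x + a , solve 2 (λ x a → :- x :+ (x :+ a) := a) refl x a , (begin
    - x * (x + a)                     ≈⟨ solve 2 (λ x a → :- x :* (x :+ a) :=
                                           con (+ 1) :+ :- con (+ 1) :* (x :* x :+ a :* x :+ con (+ 1))) refl x a ⟩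
    1# + - 1# * (x * x + a * x + 1#)  ≈⟨ +-congˡ (trans (*-congˡ root) (zeroʳ _)) ⟩
    1# + 0#                           ≈⟨ +-identityʳ 1# ⟩
    1#                                ∎)

  -- With α ≠ 0 and i = α⁻¹, β i is a root of X² + aX + 1.
  quadForm-≉0 : ∀ {a α β} → QuadIrreducible F a → ¬ (α ≈ 0# × β ≈ 0#) → ¬ quadForm a α β ≈ 0#
  quadForm-≉0 {a} {α} {β} irreducible nonzero N≈0 = irreducible (root⇒reducible (β * i) (begin
    β * i * (β * i) + a * (β * i) + 1#                                         ≈⟨ dehomogenise ⟩
    quadForm a α β * (i * i) + (α * i - 1#) * - (a * (β * i) + (1# + α * i))   ≈⟨ *+*≈0 _ _ N≈0 αi-1≈0 ⟩
    0#                                                                         ∎))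
    where
    α≉0 : ¬ α ≈ 0#
    α≉0 α≈0 = *-≉0 β≉0 β≉0 (begin
      β * β                    ≈⟨ +-identityʳ _ ⟨
      β * β + 0#               ≈⟨ +-congˡ (trans (*-congʳ α≈0) (zeroˡ _)) ⟨
      β * β + α * (α + a * β)  ≈⟨ solve 3 (λ a α β → β :* β :+ α :* (α :+ a :* β) := ℙ.quadForm a α β)
                                    refl a α β ⟩
      quadForm a α β           ≈⟨ N≈0 ⟩
      0#                       ∎)
      where β≉0 = λ β≈0 → nonzero (α≈0 , β≈0)
    i = proj₁ (inverse α α≉0)
    αi-1≈0 = x≈y⇒x∙y⁻¹≈ε (proj₂ (inverse α α≉0))
    dehomogenise : β * i * (β * i) + a * (β * i) + 1# ≈
                   quadForm a α β * (i * i) + (α * i - 1#) * - (a * (β * i) + (1# + α * i))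
    dehomogenise = solve 4 (λ a α β i →
      β :* i :* (β :* i) :+ a :* (β :* i) :+ con (+ 1) :=
      ℙ.quadForm a α β :* (i :* i) :+ (α :* i :- con (+ 1)) :* :- (a :* (β :* i) :+ (con (+ 1) :+ α :* i)))
      refl a α β i

  -- With α ≠ 0 and i = α⁻¹, β i is a root of X³ - 3X - a.
  binaryCubic-≉0 : ∀ {a α β} → NoCubicRoot a → ¬ (α ≈ 0# × β ≈ 0#) → ¬ binaryCubic a α β ≈ 0#
  binaryCubic-≉0 {a} {α} {β} noRoot nonzero g≈0 = noRoot (β * i) (x∙y⁻¹≈ε⇒x≈y _ a (begin
    β * i * (β * i * (β * i)) - three * (β * i) - a                       ≈⟨ dehomogenise ⟩
    binaryCubic a α β * (i * (i * i)) + (α * i - 1#) * r                  ≈⟨ *+*≈0 _ _ g≈0 αi-1≈0 ⟩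
    0#                                                                    ∎))
    where
    α≉0 : ¬ α ≈ 0#
    α≉0 α≈0 = *-≉0 β≉0 (*-≉0 β≉0 β≉0) (begin
      β * (β * β)                                        ≈⟨ +-identityʳ _ ⟨
      β * (β * β) + 0#                                   ≈⟨ +-congˡ (trans (*-congʳ α≈0) (zeroˡ _)) ⟨
      β * (β * β) + α * (- (three * α * β) - a * α * α)  ≈⟨ solve 3 (λ a α β →
        β :* (β :* β) :+ α :* (:- (ℙ.three :* α :* β) :- a :* α :* α) := ℙ.binaryCubic a α β) refl a α β ⟩
      binaryCubic a α β                                  ≈⟨ g≈0 ⟩
      0#                                                 ∎)
      where β≉0 = λ β≈0 → nonzero (α≈0 , β≈0)
    i = proj₁ (inverse α α≉0)
    αi-1≈0 = x≈y⇒x∙y⁻¹≈ε (proj₂ (inverse α α≉0))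
    r = three * (β * i) * (α * i + 1#) + a * (α * i * (α * i) + α * i + 1#)
    dehomogenise : β * i * (β * i * (β * i)) - three * (β * i) - a ≈
                   binaryCubic a α β * (i * (i * i)) + (α * i - 1#) * r
    dehomogenise = solve 4 (λ a α β i →
      β :* i :* (β :* i :* (β :* i)) :- ℙ.three :* (β :* i) :- a :=
      ℙ.binaryCubic a α β :* (i :* (i :* i)) :+ (α :* i :- con (+ 1)) :*
        (ℙ.three :* (β :* i) :* (α :* i :+ con (+ 1)) :+ a :* (α :* i :* (α :* i) :+ α :* i :+ con (+ 1))))
      refl a α β i

  cubic-constant⇒nonconstant : ∀ {a a₁ x} → NoCubicRoot a₁ → cubic a x ≈ᶜ constant a₁ →
                               ¬ (x 2F ≈ 0# × x 1F ≈ 0#)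
  cubic-constant⇒nonconstant {a} {a₁} {x} noRoot cubic≈ (x₂≈0 , x₁≈0) = noRoot (x 0F) (begin
    x 0F * (x 0F * x 0F) - three * x 0F                 ≈⟨ +-identityʳ _ ⟨
    x 0F * (x 0F * x 0F) - three * x 0F + 0#            ≈⟨ +-congˡ (*+*≈0 _ _ x₁≈0 x₂≈0) ⟨
    x 0F * (x 0F * x 0F) - three * x 0F + (x 1F * p + x 2F * q)  ≈⟨ expand ⟨
    cubic a x 0F                                        ≈⟨ cubic≈ 0F ⟩
    a₁                                                  ∎)
    where
    p = x 1F * x 1F * a
    q = six * x 1F * x 0F * a + three * three * x 2F * x 1F * a + x 2F * x 2F * a * a
    expand : cubic a x 0F ≈ x 0F * (x 0F * x 0F) - three * x 0F + (x 1F * p + x 2F * q)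
    expand = solve 4 (λ a x₀ x₁ x₂ →
      ℙ.cubic a (x₀ ◂ x₁ ◂ x₂ ◂ ⟨⟩) 0F :=
      x₀ :* (x₀ :* x₀) :- ℙ.three :* x₀ :+ (x₁ :* (x₁ :* x₁ :* a) :+
        x₂ :* (ℙ.six :* x₁ :* x₀ :* a :+ ℙ.three :* ℙ.three :* x₂ :* x₁ :* a :+ x₂ :* x₂ :* a :* a)))
      refl a (x 0F) (x 1F) (x 2F)

  -- x₀ + 2x₂ is a third of the trace of x₀ + x₁y + x₂y², and X³ - 3X - a₁ has no X²-term.
  cubic-constant⇒traceless : ∀ {a a₁ x} → charNot3 F → NoCubicRoot a → NoCubicRoot a₁ →
                             cubic a x ≈ᶜ constant a₁ → x 0F ≈ - (two * x 2F)
  cubic-constant⇒traceless {a} {a₁} {x} char≠3 noRoot noRoot₁ cubic≈ =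
    inverseˡ-unique _ _ (cancelˡ g≉0 (trans (*-comm _ _) (cancelˡ char≠3 (begin
      three * ((x 0F + two * x 2F) * binaryCubic a (x 2F) (x 1F))  ≈⟨ trace-identity ⟩
      x 1F * cubic a x 2F - x 2F * cubic a x 1F                    ≈⟨ +-cong (*-congˡ (cubic≈ 2F))
                                                                              (-‿cong (*-congˡ (cubic≈ 1F))) ⟩
      x 1F * 0# - x 2F * 0#                                        ≈⟨ +-cong (zeroʳ _) (-‿cong (zeroʳ _)) ⟩
      0# - 0#                                                      ≈⟨ -‿inverseʳ 0# ⟩
      0#                                                           ∎))))
    where
    g≉0 = binaryCubic-≉0 noRoot (cubic-constant⇒nonconstant noRoot₁ cubic≈)
    trace-identity : three * ((x 0F + two * x 2F) * binaryCubic a (x 2F) (x 1F)) ≈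
                     x 1F * cubic a x 2F - x 2F * cubic a x 1F
    trace-identity = solve 4 (λ a x₀ x₁ x₂ → let x′ = x₀ ◂ x₁ ◂ x₂ ◂ ⟨⟩ in
      ℙ.three :* ((x₀ :+ ℙ.two :* x₂) :* ℙ.binaryCubic a x₂ x₁) :=
      x₁ :* ℙ.cubic a x′ 2F :- x₂ :* ℙ.cubic a x′ 1F)
      refl a (x 0F) (x 1F) (x 2F)

  cubic-substituted : ∀ a α β → cubic a (substituted α β) ≈ᶜ
    (cubicParameter a α β ◂ three * (β * (quadForm a α β - 1#)) ◂ three * (α * (quadForm a α β - 1#)) ◂ ⟨⟩)
  cubic-substituted a α β 0F = solve 3 (λ a α β →
    ℙ.cubic a (ℙ.substituted α β) 0F := ℙ.cubicParameter a α β) refl a α β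
  cubic-substituted a α β 1F = solve 3 (λ a α β →
    ℙ.cubic a (ℙ.substituted α β) 1F := ℙ.three :* (β :* (ℙ.quadForm a α β :- con (+ 1)))) refl a α β
  cubic-substituted a α β 2F = solve 3 (λ a α β →
    ℙ.cubic a (ℙ.substituted α β) 2F := ℙ.three :* (α :* (ℙ.quadForm a α β :- con (+ 1)))) refl a α β

  quadForm≈1⇒nonzero : ∀ {a α β} → quadForm a α β ≈ 1# → ¬ (α ≈ 0# × β ≈ 0#)
  quadForm≈1⇒nonzero {a} {α} {β} N≈1 (α≈0 , β≈0) = 1≉0 (begin
    1#                       ≈⟨ N≈1 ⟨
    quadForm a α β           ≈⟨ solve 3 (λ a α β → ℙ.quadForm a α β := α :* (α :+ a :* β) :+ β :* β)
                                   refl a α β ⟩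
    α * (α + a * β) + β * β  ≈⟨ *+*≈0 _ _ α≈0 β≈0 ⟩
    0#                       ∎)

  cubic-substituted-constant⇒parameters : ∀ {a a₁ α β} → charNot3 F → QuadIrreducible F a →
    ¬ (α ≈ 0# × β ≈ 0#) → cubic a (substituted α β) ≈ᶜ constant a₁ → quadForm a α β ≈ 1# × a₁ ≈ cubicParameter a α β
  cubic-substituted-constant⇒parameters {a} {a₁} {α} {β} char≠3 irreducible nonzero cubic≈ =
    x∙y⁻¹≈ε⇒x≈y _ _ (cancelˡ (quadForm-≉0 irreducible nonzero) (begin
      N * (N - 1#)                                   ≈⟨ solve 3 (λ a α β → let N = ℙ.quadForm a α β in
        N :* (N :- con (+ 1)) := α :* (N :- con (+ 1)) :* α :+ β :* (N :- con (+ 1)) :* (a :* α :+ β))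
        refl a α β ⟩
      α * (N - 1#) * α + β * (N - 1#) * (a * α + β)  ≈⟨ *+*≈0 _ _ α[N-1]≈0 β[N-1]≈0 ⟩
      0#                                             ∎))
    , trans (sym (cubic≈ 0F)) (cubic-substituted a α β 0F)
    where
    N = quadForm a α β
    α[N-1]≈0 : α * (N - 1#) ≈ 0#
    α[N-1]≈0 = cancelˡ char≠3 (trans (sym (cubic-substituted a α β 2F)) (cubic≈ 2F))
    β[N-1]≈0 : β * (N - 1#) ≈ 0#
    β[N-1]≈0 = cancelˡ char≠3 (trans (sym (cubic-substituted a α β 1F)) (cubic≈ 1F))

  parameters⇒cubic-substituted-constant : ∀ {a a₁ α β} → quadForm a α β ≈ 1# → a₁ ≈ cubicParameter a α β →
                                cubic a (substituted α β) ≈ᶜ constant a₁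
  parameters⇒cubic-substituted-constant {a} {a₁} {α} {β} N≈1 a₁≈ = λ
    { 0F → trans (cubic-substituted a α β 0F) (sym a₁≈)
    ; 1F → trans (cubic-substituted a α β 1F) (three*[-*[N-1]]≈0 β)
    ; 2F → trans (cubic-substituted a α β 2F) (three*[-*[N-1]]≈0 α)
    }
    where
    three*[-*[N-1]]≈0 : ∀ x → three * (x * (quadForm a α β - 1#)) ≈ 0#
    three*[-*[N-1]]≈0 x = begin
      three * (x * (quadForm a α β - 1#))  ≈⟨ *-congˡ (*-congˡ (x≈y⇒x∙y⁻¹≈ε N≈1)) ⟩
      three * (x * 0#)                     ≈⟨ *-congˡ (zeroʳ x) ⟩
      three * 0#                           ≈⟨ zeroʳ three ⟩
      0#                                   ∎

  substitute-inverse : ∀ {a α β D} → binaryCubic a α β * D ≈ 1# →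
                       substitute a (inverseSubstitution a α β D) (substituted α β) ≈ᶜ generator
  substitute-inverse {a} {α} {β} {D} gD≈1 = λ
    { 0F → solve 4 (λ a α β D → composite a α β D 0F := con (+ 0)) refl a α β D
    ; 1F → trans (solve 4 (λ a α β D → composite a α β D 1F := ℙ.binaryCubic a α β :* D) refl a α β D) gD≈1
    ; 2F → solve 4 (λ a α β D → composite a α β D 2F := con (+ 0)) refl a α β D
    }
    where
    composite : ∀ {n} → Polynomial n → Polynomial n → Polynomial n → Polynomial n → ℙ.Coords
    composite a α β D = ℙ.substitute a (ℙ.inverseSubstitution a α β D) (ℙ.substituted α β)

module ExtensionProperties {c ℓ c₁ ℓ₁} {F : Field c ℓ} (E : Extension F c₁ ℓ₁) where
  private module F = Field F
  open Extension E
  open RingMorphisms.IsRingHomomorphism ι-hom public using ()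
    renaming (⟦⟧-cong to ι-cong; +-homo to ι-+; *-homo to ι-*; -‿homo to ι-neg; 0#-homo to ι-0; 1#-homo to ι-1)
  open FieldProperties L using (x≈y⇒x∙y⁻¹≈ε)
  open CubicAlgebra F using (_≈ᶜ_; NoCubicRoot)
  open CubicFormulas F.rawRing
    using (Coords; _+ᶜ_; -ᶜ_; _·ᶜ_; constant; generator; multiply; cubic; substitute; substituted)
  open CubicFormulas rawRing public using (powers)
  open Matrix3 rawRing using (_∙_)
  open Matrix3Properties commutativeRing using (∙-congˡ; ∙-congʳ)
  open IntegerCoefficients commutativeRing using (solve; _:=_; _:+_; _:*_; :-_; con; polynomialRawRing)
  private
    module ML = Matrix3 rawRing
    module CL = CubicFormulas rawRing
    module MF = Matrix3 F.rawRing
    module ℙ {n} = CubicFormulas (polynomialRawRing n)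
    module ℙM {n} = Matrix3 (polynomialRawRing n)
    module 𝕋 {n} = RawRingNotation (termRawRing n)
    ι-⟦⟧ᵗ = ⟦⟧ᵗ-homo {S = ring} ι-hom
  open import Relation.Binary.Reasoning.Setoid setoid

  lin3-cong : ∀ {k k′} e → k ≈ᶜ k′ → lin3 k e ≈ lin3 k′ e
  lin3-cong {k} {k′} e k≈ = ∙-congˡ (ι ∘ k) (ι ∘ k′) e (λ i → ι-cong (k≈ i))

  lin3-+ : ∀ k k′ e → lin3 k e + lin3 k′ e ≈ lin3 (k +ᶜ k′) e
  lin3-+ k k′ e = trans
    (solve 9 (λ k₀ k₁ k₂ l₀ l₁ l₂ e₀ e₁ e₂ →
      let k″ = k₀ ◂ k₁ ◂ k₂ ◂ ⟨⟩ ; l″ = l₀ ◂ l₁ ◂ l₂ ◂ ⟨⟩ ; e″ = e₀ ◂ e₁ ◂ e₂ ◂ ⟨⟩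
      in (k″ ℙM.∙ e″) :+ (l″ ℙM.∙ e″) := (k″ ℙ.+ᶜ l″) ℙM.∙ e″)
      refl (ι (k 0F)) (ι (k 1F)) (ι (k 2F)) (ι (k′ 0F)) (ι (k′ 1F)) (ι (k′ 2F)) (e 0F) (e 1F) (e 2F))
    (∙-congˡ _ (ι ∘ (k +ᶜ k′)) e (λ i → sym (ι-+ (k i) (k′ i))))

  lin3-neg : ∀ k e → - lin3 k e ≈ lin3 (-ᶜ k) e
  lin3-neg k e = trans
    (solve 6 (λ k₀ k₁ k₂ e₀ e₁ e₂ → let k″ = k₀ ◂ k₁ ◂ k₂ ◂ ⟨⟩ ; e″ = e₀ ◂ e₁ ◂ e₂ ◂ ⟨⟩ in
      :- (k″ ℙM.∙ e″) := (ℙ.-ᶜ k″) ℙM.∙ e″)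
      refl (ι (k 0F)) (ι (k 1F)) (ι (k 2F)) (e 0F) (e 1F) (e 2F))
    (∙-congˡ _ (ι ∘ (-ᶜ k)) e (λ i → sym (ι-neg (k i))))

  lin3-· : ∀ a k e → ι a * lin3 k e ≈ lin3 (a ·ᶜ k) e
  lin3-· a k e = trans
    (solve 7 (λ a k₀ k₁ k₂ e₀ e₁ e₂ → let k″ = k₀ ◂ k₁ ◂ k₂ ◂ ⟨⟩ ; e″ = e₀ ◂ e₁ ◂ e₂ ◂ ⟨⟩ in
      a :* (k″ ℙM.∙ e″) := (a ℙ.·ᶜ k″) ℙM.∙ e″)
      refl (ι a) (ι (k 0F)) (ι (k 1F)) (ι (k 2F)) (e 0F) (e 1F) (e 2F))
    (∙-congˡ _ (ι ∘ (a ·ᶜ k)) e (λ i → sym (ι-* a (k i))))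

  lin3-injective : ∀ e → IsBasis3 e → ∀ k k′ → lin3 k e ≈ lin3 k′ e → k ≈ᶜ k′
  lin3-injective e (_ , independent) k k′ k≈k′ i =
    FieldProperties.x∙y⁻¹≈ε⇒x≈y F (k i) (k′ i) (independent (k +ᶜ -ᶜ k′) (begin
      lin3 (k +ᶜ -ᶜ k′) e        ≈⟨ lin3-+ k (-ᶜ k′) e ⟨
      lin3 k e + lin3 (-ᶜ k′) e  ≈⟨ +-congˡ (lin3-neg k′ e) ⟨
      lin3 k e - lin3 k′ e       ≈⟨ x≈y⇒x∙y⁻¹≈ε k≈k′ ⟩
      0#                         ∎) i)

  lin3-identity : ∀ e j → lin3 (MF.identity j) e ≈ e j
  lin3-identity e 0F = trans (∙-congˡ (ι ∘ MF.identity 0F) (ML.identity 0F) e λ { 0F → ι-1 ; 1F → ι-0 ; 2F → ι-0 })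
    (solve 3 (λ e₀ e₁ e₂ → ℙM.identity 0F ℙM.∙ (e₀ ◂ e₁ ◂ e₂ ◂ ⟨⟩) := e₀) refl (e 0F) (e 1F) (e 2F))
  lin3-identity e 1F = trans (∙-congˡ (ι ∘ MF.identity 1F) (ML.identity 1F) e λ { 0F → ι-0 ; 1F → ι-1 ; 2F → ι-0 })
    (solve 3 (λ e₀ e₁ e₂ → ℙM.identity 1F ℙM.∙ (e₀ ◂ e₁ ◂ e₂ ◂ ⟨⟩) := e₁) refl (e 0F) (e 1F) (e 2F))
  lin3-identity e 2F = trans (∙-congˡ (ι ∘ MF.identity 2F) (ML.identity 2F) e λ { 0F → ι-0 ; 1F → ι-0 ; 2F → ι-1 })
    (solve 3 (λ e₀ e₁ e₂ → ℙM.identity 2F ℙM.∙ (e₀ ◂ e₁ ◂ e₂ ◂ ⟨⟩) := e₂) refl (e 0F) (e 1F) (e 2F))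

  lin3-⊛ : ∀ t M e → lin3 t (λ i → lin3 (M i) e) ≈ lin3 (t MF.⊛ M) e
  lin3-⊛ t M e = begin
    lin3 t (λ i → lin3 (M i) e)
      ≈⟨ +-cong (lin3-· (t 0F) (M 0F) e) (+-cong (lin3-· (t 1F) (M 1F) e) (lin3-· (t 2F) (M 2F) e)) ⟩
    lin3 (t 0F ·ᶜ M 0F) e + (lin3 (t 1F ·ᶜ M 1F) e + lin3 (t 2F ·ᶜ M 2F) e)
      ≈⟨ +-congˡ (lin3-+ (t 1F ·ᶜ M 1F) (t 2F ·ᶜ M 2F) e) ⟩
    lin3 (t 0F ·ᶜ M 0F) e + lin3 (t 1F ·ᶜ M 1F +ᶜ t 2F ·ᶜ M 2F) e
      ≈⟨ lin3-+ (t 0F ·ᶜ M 0F) (t 1F ·ᶜ M 1F +ᶜ t 2F ·ᶜ M 2F) e ⟩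
    lin3 (t MF.⊛ M) e
      ∎

  Spans : Vector Carrier 3 → Set (c ⊔ c₁ ⊔ ℓ₁)
  Spans v = ∀ x → ∃ λ k → x ≈ lin3 k v

  -- Writing v in the basis e and e in terms of v gives matrices with N ⊗ M = 1.
  spanning⇒basis : Degree3 → ∀ v → Spans v → IsBasis3 v
  spanning⇒basis (e , e-spans , e-independent) v v-spans = v-spans , independent
    where
    open Matrix3Properties F.commutativeRing using (left-invertible⇒trivial-kernel)
    M N : MF.Matrix
    M i = proj₁ (e-spans (v i))
    N j = proj₁ (v-spans (e j))
    lin3-M : ∀ t → lin3 t v ≈ lin3 (t MF.⊛ M) e
    lin3-M t = trans (∙-congʳ (ι ∘ t) v (λ i → lin3 (M i) e) (λ i → proj₂ (e-spans (v i)))) (lin3-⊛ t M e)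
    N⊗M≈I : ∀ i j → (N MF.⊗ M) i j F.≈ MF.identity i j
    N⊗M≈I i = lin3-injective e (e-spans , e-independent) (N i MF.⊛ M) (MF.identity i) (begin
      lin3 (N i MF.⊛ M) e     ≈⟨ lin3-M (N i) ⟨
      lin3 (N i) v            ≈⟨ proj₂ (v-spans (e i)) ⟨
      e i                     ≈⟨ lin3-identity e i ⟨
      lin3 (MF.identity i) e  ∎)
    independent : ∀ t → lin3 t v ≈ 0# → ∀ i → t i F.≈ F.0#
    independent t t·v≈0 =
      left-invertible⇒trivial-kernel N M t N⊗M≈I (e-independent (t MF.⊛ M) (trans (sym (lin3-M t)) t·v≈0))

  poly : Coords → Carrier → Carrier
  poly k v = lin3 k (powers v)

  IsRoot : Carrier → F.Carrier → Set ℓ₁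
  IsRoot v a = v * (v * v) - three * v ≈ ι a

  ι-three : ι F.three ≈ three
  ι-three = ι-⟦⟧ᵗ (𝕋.three {0}) ⟨⟩

  ι-multiply : ∀ a x y i → ι (multiply a x y i) ≈ CL.multiply (ι a) (ι ∘ x) (ι ∘ y) i
  ι-multiply a x y = λ { 0F → transport 0F ; 1F → transport 1F ; 2F → transport 2F }
    where
    product = CubicFormulas.multiply (termRawRing 7)
      (var 0F) (var 1F ◂ var 2F ◂ var 3F ◂ ⟨⟩) (var 4F ◂ var 5F ◂ var 6F ◂ ⟨⟩)
    environment = a ◂ x 0F ◂ x 1F ◂ x 2F ◂ y 0F ◂ y 1F ◂ y 2F ◂ ⟨⟩
    transport : ∀ i → ι (⟦ F.rawRing ⟧ᵗ (product i) environment) ≈ ⟦ rawRing ⟧ᵗ (product i) (ι ∘ environment)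
    transport i = ι-⟦⟧ᵗ (product i) environment

  poly-constant : ∀ a v → ι a ≈ poly (constant a) v
  poly-constant a v = sym (trans
    (∙-congˡ (ι ∘ constant a) (CL.constant (ι a)) (powers v) λ { 0F → refl ; 1F → ι-0 ; 2F → ι-0 })
    (solve 2 (λ a v → ℙ.constant a ℙM.∙ ℙ.powers v := a) refl (ι a) v))

  poly-generator : ∀ v → v ≈ poly generator v
  poly-generator v = sym (trans
    (∙-congˡ (ι ∘ generator) CL.generator (powers v) λ { 0F → ι-0 ; 1F → ι-1 ; 2F → ι-0 })
    (solve 1 (λ v → ℙ.generator ℙM.∙ ℙ.powers v := v) refl v))

  poly-* : ∀ {v a} → IsRoot v a → ∀ x y → poly x v * poly y v ≈ poly (multiply a x y) v
  poly-* {v} {a} root x y = begin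
    poly x v * poly y v                      ≈⟨ reduce-mod-cubic ⟩
    product ∙ powers v + r * (v * (v * v) - three * v - ι a)
                                             ≈⟨ +-congˡ (trans (*-congˡ (x≈y⇒x∙y⁻¹≈ε root)) (zeroʳ r)) ⟩
    product ∙ powers v + 0#                  ≈⟨ +-identityʳ _ ⟩
    product ∙ powers v                       ≈⟨ ∙-congˡ _ _ (powers v) (λ i → sym (ι-multiply a x y i)) ⟩
    poly (multiply a x y) v                  ∎
    where
    product = CL.multiply (ι a) (ι ∘ x) (ι ∘ y)
    r = ι (x 1F) * ι (y 2F) + ι (x 2F) * ι (y 1F) + ι (x 2F) * ι (y 2F) * v
    reduce-mod-cubic : poly x v * poly y v ≈ product ∙ powers v + r * (v * (v * v) - three * v - ι a)
    reduce-mod-cubic = solve 8 (λ a x₀ x₁ x₂ y₀ y₁ y₂ v →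
      let x″ = x₀ ◂ x₁ ◂ x₂ ◂ ⟨⟩ ; y″ = y₀ ◂ y₁ ◂ y₂ ◂ ⟨⟩ in
      (x″ ℙM.∙ ℙ.powers v) :* (y″ ℙM.∙ ℙ.powers v) :=
      ℙ.multiply a x″ y″ ℙM.∙ ℙ.powers v :+
        (x₁ :* y₂ :+ x₂ :* y₁ :+ x₂ :* y₂ :* v) :* (v :* (v :* v) ℙ.- ℙ.three :* v ℙ.- a))
      refl (ι a) (ι (x 0F)) (ι (x 1F)) (ι (x 2F)) (ι (y 0F)) (ι (y 1F)) (ι (y 2F)) v

  poly-cubic : ∀ {v a} → IsRoot v a → ∀ {w} k → w ≈ poly k v → w * (w * w) - three * w ≈ poly (cubic a k) v
  poly-cubic {v} {a} root {w} k w≈ = begin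
    w * (w * w) - three * w
      ≈⟨ +-cong (*-cong w≈ (*-cong w≈ w≈)) (-‿cong (*-cong (sym ι-three) w≈)) ⟩
    poly k v * (poly k v * poly k v) - ι F.three * poly k v
      ≈⟨ +-cong (*-congˡ (poly-* root k k)) (-‿cong (lin3-· F.three k (powers v))) ⟩
    poly k v * poly (multiply a k k) v - poly (F.three ·ᶜ k) v
      ≈⟨ +-cong (poly-* root k (multiply a k k)) (lin3-neg (F.three ·ᶜ k) (powers v)) ⟩
    poly (multiply a k (multiply a k k)) v + poly (-ᶜ (F.three ·ᶜ k)) v
      ≈⟨ lin3-+ (multiply a k (multiply a k k)) (-ᶜ (F.three ·ᶜ k)) (powers v) ⟩
    poly (cubic a k) v
      ∎

  poly-substitute : ∀ {v a} → IsRoot v a → ∀ {w} k d → w ≈ poly d v → poly k w ≈ poly (substitute a k d) v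
  poly-substitute {v} {a} root {w} k d w≈ = begin
    ι (k 0F) * 1# + (ι (k 1F) * w + ι (k 2F) * (w * w))
      ≈⟨ +-cong (trans (*-identityʳ _) (poly-constant (k 0F) v))
                (+-cong (*-congˡ w≈) (*-congˡ (trans (*-cong w≈ w≈) (poly-* root d d)))) ⟩
    poly (constant (k 0F)) v + (ι (k 1F) * poly d v + ι (k 2F) * poly (multiply a d d) v)
      ≈⟨ +-congˡ (+-cong (lin3-· (k 1F) d (powers v)) (lin3-· (k 2F) (multiply a d d) (powers v))) ⟩
    poly (constant (k 0F)) v + (poly (k 1F ·ᶜ d) v + poly (k 2F ·ᶜ multiply a d d) v)
      ≈⟨ +-congˡ (lin3-+ (k 1F ·ᶜ d) (k 2F ·ᶜ multiply a d d) (powers v)) ⟩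
    poly (constant (k 0F)) v + poly (k 1F ·ᶜ d +ᶜ k 2F ·ᶜ multiply a d d) v
      ≈⟨ lin3-+ (constant (k 0F)) (k 1F ·ᶜ d +ᶜ k 2F ·ᶜ multiply a d d) (powers v) ⟩
    poly (substitute a k d) v
      ∎

  powers-span : ∀ {v a} → IsRoot v a → Generates v → Spans (powers v)
  powers-span {v} {a} root generates x =
    let cs , x≈ = generates x ; k , p≈ = coordinates cs in k , trans x≈ p≈
    where
    coordinates : ∀ cs → ∃ λ k → evalPoly cs v ≈ poly k v
    coordinates []       = constant F.0# , trans (sym ι-0) (poly-constant F.0# v)
    coordinates (c ∷ cs) = let k , p≈ = coordinates cs in constant c +ᶜ multiply a generator k , (begin
      ι c + v * evalPoly cs v                              ≈⟨ +-cong (poly-constant c v) (*-cong (poly-generator v) p≈) ⟩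
      poly (constant c) v + poly generator v * poly k v    ≈⟨ +-congˡ (poly-* root generator k) ⟩
      poly (constant c) v + poly (multiply a generator k) v
                                                           ≈⟨ lin3-+ (constant c) (multiply a generator k) (powers v) ⟩
      poly (constant c +ᶜ multiply a generator k) v        ∎)

  powers-basis : Degree3 → ∀ {v a} → IsRoot v a → Generates v → IsBasis3 (powers v)
  powers-basis degree3 {v} root generates = spanning⇒basis degree3 (powers v) (powers-span root generates)

  -- A root s ∈ F splits off the factor y - s, and neither y - s nor y² + sy + s² - 3 can vanish
  -- since 1, y, y² are independent.
  basis⇒noCubicRoot : ∀ {v a} → IsBasis3 (powers v) → IsRoot v a → NoCubicRoot a
  basis⇒noCubicRoot {v} {a} (_ , independent) root s s-root =
    F.1≉0 (independent quadratic (trans quadratic≈ (cancelˡ linear≉0 factors≈0)) 2F)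
    where
    open FieldProperties L using (cancelˡ)
    linear quadratic : Coords
    linear    = F.- s ◂ F.1# ◂ F.0# ◂ ⟨⟩
    quadratic = s F.* s F.- F.three ◂ s ◂ F.1# ◂ ⟨⟩
    linear≈ : poly linear v ≈ v - ι s
    linear≈ = trans (∙-congˡ (ι ∘ linear) (- ι s ◂ 1# ◂ 0# ◂ ⟨⟩) (powers v) λ { 0F → ι-neg s ; 1F → ι-1 ; 2F → ι-0 })
      (solve 2 (λ v s → (:- s ◂ con (+ 1) ◂ con (+ 0) ◂ ⟨⟩) ℙM.∙ ℙ.powers v := v ℙ.- s) refl v (ι s))
    quadratic≈ : poly quadratic v ≈ v * v + ι s * v + (ι s * ι s - three)
    quadratic≈ = trans
      (∙-congˡ (ι ∘ quadratic) (ι s * ι s - three ◂ ι s ◂ 1# ◂ ⟨⟩) (powers v)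
        λ { 0F → ι-⟦⟧ᵗ (var 0F *ᵗ var 0F 𝕋.- 𝕋.three) (s ◂ ⟨⟩) ; 1F → refl ; 2F → ι-1 })
      (solve 2 (λ v s → ((s :* s ℙ.- ℙ.three) ◂ s ◂ con (+ 1) ◂ ⟨⟩) ℙM.∙ ℙ.powers v :=
                        v :* v :+ s :* v :+ (s :* s ℙ.- ℙ.three)) refl v (ι s))
    linear≉0 : ¬ v - ι s ≈ 0#
    linear≉0 v-s≈0 = F.1≉0 (independent linear (trans linear≈ v-s≈0) 1F)
    factors≈0 : (v - ι s) * (v * v + ι s * v + (ι s * ι s - three)) ≈ 0#
    factors≈0 = begin
      (v - ι s) * (v * v + ι s * v + (ι s * ι s - three))          ≈⟨ solve 2 (λ v s →
        (v ℙ.- s) :* (v :* v :+ s :* v :+ (s :* s ℙ.- ℙ.three)) :=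
        v :* (v :* v) ℙ.- ℙ.three :* v ℙ.- (s :* (s :* s) ℙ.- ℙ.three :* s)) refl v (ι s) ⟩
      v * (v * v) - three * v - (ι s * (ι s * ι s) - three * ι s)  ≈⟨ +-cong root (-‿cong
                                                                        (trans (sym (ι-⟦⟧ᵗ cubicTerm (s ◂ ⟨⟩)))
                                                                               (ι-cong s-root))) ⟩
      ι a - ι a                                                    ≈⟨ -‿inverseʳ (ι a) ⟩
      0#                                                           ∎

  root-coordinates : ∀ {v a} → IsBasis3 (powers v) → IsRoot v a →
                     ∀ {w a′} k → IsRoot w a′ → w ≈ poly k v → cubic a k ≈ᶜ constant a′
  root-coordinates {v} {a} basis root {w} {a′} k w-root w≈ =
    lin3-injective (powers v) basis (cubic a k) (constant a′) (begin
      poly (cubic a k) v         ≈⟨ poly-cubic root k w≈ ⟨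
      w * (w * w) - three * w    ≈⟨ w-root ⟩
      ι a′                       ≈⟨ poly-constant a′ v ⟩
      poly (constant a′) v       ∎)

  poly-substituted : ∀ α β v → poly (substituted α β) v ≈ ι α * (v * v) + ι β * v - ι (F.two F.* α)
  poly-substituted α β v = trans (+-congʳ (*-congʳ (ι-neg (F.two F.* α))))
    (solve 4 (λ α β v t → :- t :* con (+ 1) :+ (β :* v :+ α :* (v :* v)) := α :* (v :* v) :+ β :* v ℙ.- t)
      refl (ι α) (ι β) v (ι (F.two F.* α)))

module _ {c ℓ c₁ ℓ₁ c₂ ℓ₂} {F : Field c ℓ} {E₁ : Extension F c₁ ℓ₁} {E₂ : Extension F c₂ ℓ₂} where
  private
    module F = Field F
    module L₁ = Extension E₁
    module L₂ = Extension E₂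
    module X₁ = ExtensionProperties E₁
    module X₂ = ExtensionProperties E₂
  open CubicFormulas F.rawRing
    using (Coords; _+ᶜ_; -ᶜ_; constant; multiply; substitute; quadForm; cubicParameter; substituted;
           inverseSubstitution)
  open CubicAlgebra F

  FIso-root : (f : FIso E₁ E₂) → ∀ {y a} → X₁.IsRoot y a → X₂.IsRoot (FIso.φ f y) a
  FIso-root f {y} {a} root = L₂.trans (L₂.sym (⟦⟧ᵗ-homo {S = L₂.ring} φ-hom cubicTerm (y ◂ ⟨⟩)))
                                      (L₂.trans (⟦⟧-cong root) (FIso.φ-fixF f a))
    where
    open RingMorphisms.IsRingIsomorphism (FIso.φ-iso f) using (⟦⟧-cong) renaming (isRingHomomorphism to φ-hom)

  -- Both power bases multiply by the same rule, so matching coordinates is an F-isomorphism.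
  powerBasisIsomorphism : ∀ {a y z} → L₁.IsBasis3 (X₁.powers y) → L₂.IsBasis3 (X₂.powers z) →
                          X₁.IsRoot y a → X₂.IsRoot z a → FIso E₁ E₂
  powerBasisIsomorphism {a} {y} {z} basis₁ basis₂ root₁ root₂ = record
    { φ      = φ
    ; φ-iso  = record
      { isRingMonomorphism = record
        { isRingHomomorphism = record
          { isSemiringHomomorphism = record
            { isNearSemiringHomomorphism = record
              { +-isMonoidHomomorphism = record
                { isMagmaHomomorphism = record
                  { isRelHomomorphism = record { cong = φ-cong }
                  ; homo = φ-+ }
                ; ε-homo = L₂.trans (φ-cong (L₁.sym X₁.ι-0)) (L₂.trans (φ-ι F.0#) X₂.ι-0) }
              ; *-homo = φ-* }
            ; 1#-homo = L₂.trans (φ-cong (L₁.sym X₁.ι-1)) (L₂.trans (φ-ι F.1#) X₂.ι-1) }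
          ; -‿homo = φ-neg }
        ; injective = φ-injective }
      ; surjective = φ-surjective }
    ; φ-fixF = φ-ι
    }
    where
    coordinates : L₁.Carrier → Coords
    coordinates x = proj₁ (proj₁ basis₁ x)
    expansion : ∀ x → x L₁.≈ X₁.poly (coordinates x) y
    expansion x = proj₂ (proj₁ basis₁ x)
    φ : L₁.Carrier → L₂.Carrier
    φ x = X₂.poly (coordinates x) z
    φ-poly : ∀ {x} k → x L₁.≈ X₁.poly k y → φ x L₂.≈ X₂.poly k z
    φ-poly {x} k x≈ = X₂.lin3-cong (X₂.powers z)
      (X₁.lin3-injective (X₁.powers y) basis₁ (coordinates x) k (L₁.trans (L₁.sym (expansion x)) x≈))
    φ-cong : ∀ {x x′} → x L₁.≈ x′ → φ x L₂.≈ φ x′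
    φ-cong {x′ = x′} x≈x′ = φ-poly (coordinates x′) (L₁.trans x≈x′ (expansion x′))
    φ-+ : ∀ x x′ → φ (x L₁.+ x′) L₂.≈ φ x L₂.+ φ x′
    φ-+ x x′ = L₂.trans
      (φ-poly (k +ᶜ k′) (L₁.trans (L₁.+-cong (expansion x) (expansion x′)) (X₁.lin3-+ k k′ (X₁.powers y))))
      (L₂.sym (X₂.lin3-+ k k′ (X₂.powers z)))
      where k = coordinates x ; k′ = coordinates x′
    φ-* : ∀ x x′ → φ (x L₁.* x′) L₂.≈ φ x L₂.* φ x′
    φ-* x x′ = L₂.trans
      (φ-poly (multiply a k k′) (L₁.trans (L₁.*-cong (expansion x) (expansion x′)) (X₁.poly-* root₁ k k′)))
      (L₂.sym (X₂.poly-* root₂ k k′))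
      where k = coordinates x ; k′ = coordinates x′
    φ-neg : ∀ x → φ (L₁.- x) L₂.≈ L₂.- φ x
    φ-neg x = L₂.trans
      (φ-poly (-ᶜ k) (L₁.trans (L₁.-‿cong (expansion x)) (X₁.lin3-neg k (X₁.powers y))))
      (L₂.sym (X₂.lin3-neg k (X₂.powers z)))
      where k = coordinates x
    φ-ι : ∀ c → φ (L₁.ι c) L₂.≈ L₂.ι c
    φ-ι c = L₂.trans (φ-poly (constant c) (X₁.poly-constant c y)) (L₂.sym (X₂.poly-constant c z))
    φ-injective : ∀ {x x′} → φ x L₂.≈ φ x′ → x L₁.≈ x′
    φ-injective {x} {x′} φx≈φx′ = L₁.trans (expansion x) (L₁.trans
      (X₁.lin3-cong (X₁.powers y) (X₂.lin3-injective (X₂.powers z) basis₂ (coordinates x) (coordinates x′) φx≈φx′))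
      (L₁.sym (expansion x′)))
    φ-surjective : ∀ w → ∃ λ x → ∀ {x′} → x′ L₁.≈ x → φ x′ L₂.≈ w
    φ-surjective w = X₁.poly k y , λ x′≈ → L₂.trans (φ-poly k x′≈) (L₂.sym (proj₂ (proj₁ basis₂ w)))
      where k = proj₁ (proj₁ basis₂ w)

  module _ (char≠3 : charNot3 F) {a₁ a₂ y₁ y₂}
           (basis₁ : L₁.IsBasis3 (X₁.powers y₁)) (basis₂ : L₂.IsBasis3 (X₂.powers y₂))
           (root₁ : X₁.IsRoot y₁ a₁) (root₂ : X₂.IsRoot y₂ a₂) where

    isomorphism⇒parameters : QuadIrreducible F a₂ → (f : FIso E₁ E₂) →
      ∃ λ α → ∃ λ β → quadForm a₂ α β F.≈ F.1# × a₁ F.≈ cubicParameter a₂ α β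
                      × FIso.φ f y₁ L₂.≈ X₂.poly (substituted α β) y₂
    isomorphism⇒parameters irreducible₂ f = α , β , proj₁ parameters , proj₂ parameters , w≈substituted
      where
      w = FIso.φ f y₁
      w-root = FIso-root f root₁
      Z = proj₁ (proj₁ basis₂ w)
      w≈Z = proj₂ (proj₁ basis₂ w)
      cubic≈ = X₂.root-coordinates basis₂ root₂ Z w-root w≈Z
      noRoot₁ = X₁.basis⇒noCubicRoot basis₁ root₁
      α = Z 2F
      β = Z 1F
      Z≈substituted : Z ≈ᶜ substituted α β
      Z≈substituted = λ
        { 0F → cubic-constant⇒traceless char≠3 (X₂.basis⇒noCubicRoot basis₂ root₂) noRoot₁ cubic≈
        ; 1F → F.refl
        ; 2F → F.refl }
      w≈substituted = L₂.trans w≈Z (X₂.lin3-cong (X₂.powers y₂) Z≈substituted)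
      parameters = cubic-substituted-constant⇒parameters char≠3 irreducible₂
        (cubic-constant⇒nonconstant noRoot₁ cubic≈)
        (X₂.root-coordinates basis₂ root₂ (substituted α β) w-root w≈substituted)

    parameters⇒isomorphism : ∀ {α β} → quadForm a₂ α β F.≈ F.1# → a₁ F.≈ cubicParameter a₂ α β → FIso E₁ E₂
    parameters⇒isomorphism {α} {β} N≈1 a₁≈ = powerBasisIsomorphism basis₁ z-basis root₁ z-root
      where
      z = X₂.poly (substituted α β) y₂
      z-root : X₂.IsRoot z a₁
      z-root = L₂.trans (X₂.poly-cubic root₂ (substituted α β) L₂.refl) (L₂.trans
        (X₂.lin3-cong (X₂.powers y₂) (parameters⇒cubic-substituted-constant N≈1 a₁≈))
        (L₂.sym (X₂.poly-constant a₁ y₂)))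
      g≉0 = binaryCubic-≉0 (X₂.basis⇒noCubicRoot basis₂ root₂) (quadForm≈1⇒nonzero N≈1)
      y-coordinates = inverseSubstitution a₂ α β (proj₁ (F.inverse _ g≉0))
      y₂≈ : y₂ L₂.≈ X₂.poly y-coordinates z
      y₂≈ = L₂.sym (L₂.trans (X₂.poly-substitute root₂ y-coordinates (substituted α β) L₂.refl) (L₂.trans
        (X₂.lin3-cong (X₂.powers y₂) (substitute-inverse (proj₂ (F.inverse _ g≉0))))
        (L₂.sym (X₂.poly-generator y₂))))
      z-spans : X₂.Spans (X₂.powers z)
      z-spans x = let k , x≈ = proj₁ basis₂ x in
        substitute a₁ k y-coordinates , L₂.trans x≈ (X₂.poly-substitute z-root k y-coordinates y₂≈)
      z-basis = X₂.spanning⇒basis (X₂.powers y₂ , basis₂) (X₂.powers z) z-spans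

mainTheorem3 : {c ℓ c₁ ℓ₁ c₂ ℓ₂ : Level} (F : Field c ℓ) → charNot3 F →
  (E₁ : Extension F c₁ ℓ₁) (E₂ : Extension F c₂ ℓ₂) →
  Extension.Degree3 E₁ → Extension.Degree3 E₂ →
  (a₁ a₂ : Field.Carrier F) (y₁ : Extension.Carrier E₁) (y₂ : Extension.Carrier E₂) →
  Extension.Generates E₁ y₁ → Extension.Generates E₂ y₂ →
  Extension._≈_ E₁ (Extension._-_ E₁ (Extension._*_ E₁ y₁ (Extension._*_ E₁ y₁ y₁)) (Extension._*_ E₁ (Extension.three E₁) y₁)) (Extension.ι E₁ a₁) →
  Extension._≈_ E₂ (Extension._-_ E₂ (Extension._*_ E₂ y₂ (Extension._*_ E₂ y₂ y₂)) (Extension._*_ E₂ (Extension.three E₂) y₂)) (Extension.ι E₂ a₂) →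
  QuadIrreducible F a₁ → QuadIrreducible F a₂ →
  let open Field F in
  let module L₂ = Extension E₂ in
  -- (1) ⇔ (2)
  ((Isomorphic E₁ E₂ →
      ∃ λ α → ∃ λ β → (α * α + a₂ * α * β + β * β ≈ 1#) ×
        ∃ λ (f : FIso E₁ E₂) →
          FIso.φ f y₁ L₂.≈ L₂.ι α L₂.* (y₂ L₂.* y₂) L₂.+ L₂.ι β L₂.* y₂ L₂.- L₂.ι (two * α))
   × ((∃ λ α → ∃ λ β → (α * α + a₂ * α * β + β * β ≈ 1#) ×
        ∃ λ (f : FIso E₁ E₂) →
          FIso.φ f y₁ L₂.≈ L₂.ι α L₂.* (y₂ L₂.* y₂) L₂.+ L₂.ι β L₂.* y₂ L₂.- L₂.ι (two * α))
      → Isomorphic E₁ E₂))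
  -- (1) ⇔ (3)
  × ((Isomorphic E₁ E₂ →
      ∃ λ α → ∃ λ β → (α * α + a₂ * α * β + β * β ≈ 1#) ×
        (a₁ ≈ - (three * a₂ * α * α * β) + a₂ * β * β * β + six * α
               + α * α * α * a₂ * a₂ - eight * α * α * α))
   × ((∃ λ α → ∃ λ β → (α * α + a₂ * α * β + β * β ≈ 1#) ×
        (a₁ ≈ - (three * a₂ * α * α * β) + a₂ * β * β * β + six * α
               + α * α * α * a₂ * a₂ - eight * α * α * α))
      → Isomorphic E₁ E₂))
mainTheorem3 F char≠3 E₁ E₂ degree₁ degree₂ a₁ a₂ y₁ y₂ generates₁ generates₂ root₁ root₂ _ irreducible₂ =
  ( (λ f → let α , β , N≈1 , _ , φy₁≈ = to-parameters f in
             α , β , N≈1 , f , L₂.trans φy₁≈ (X₂.poly-substituted α β y₂))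
  , (λ (_ , _ , _ , f , _) → f) )
  , ( (λ f → let α , β , N≈1 , a₁≈ , _ = to-parameters f in α , β , N≈1 , a₁≈)
    , (λ (_ , _ , N≈1 , a₁≈) → parameters⇒isomorphism char≠3 basis₁ basis₂ root₁ root₂ N≈1 a₁≈) )
  where
  module L₂ = Extension E₂
  module X₁ = ExtensionProperties E₁
  module X₂ = ExtensionProperties E₂
  basis₁ = X₁.powers-basis degree₁ root₁ generates₁
  basis₂ = X₂.powers-basis degree₂ root₂ generates₂
  to-parameters = isomorphism⇒parameters char≠3 basis₁ basis₂ root₁ root₂ irreducible₂
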